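{- Let $\mathcal B_1$ and $\mathcal B_2$ be the collections of bases of matroids $M_1$ and $M_2$ on $[n]$ of ranks $k$ and $k-1$ respectively. Then $M_2$ is an elementary quotient of $M_1$ if and only if both of the following hold: (a) for every $B_1\in\mathcal B_1$, $B_2\in\mathcal B_2$ and $i\in B_1\triangle B_2$, either (1) $B_1\triangle\{i\}\in\mathcal B_2$ and $B_2\triangle\{i\}\in\mathcal B_1$, or (2) there exists $j\in B_1\triangle B_2$ such that $B_1\triangle\{i,j\}\in\mathcal B_1$ and $B_2\triangle\{i,j\}\in\mathcal B_2$; and (b) for every $B_1\in\mathcal B_1$, $B_2\in\mathcal B_2$ there exists $i\in B_1\triangle B_2$ such that case (1) holds.
   Context: $\triangle$ denotes symmetric difference. $M_2$ is a quotient of $M_1$ if every circuit of $M_1$ is a union of circuits of $M_2$; it is an elementary quotient if moreover the rank of $M_2$ is one less than that of $M_1$. -}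

module Defs where

open import Data.Nat using (ℕ; suc)
open import Data.Bool using (Bool; true)
open import Data.Fin using (Fin)
open import Data.Fin.Subset using (Subset; _∈_; _∉_; _⊆_; _⊂_; _∪_; _─_; _-_; ⁅_⁆; ∣_∣)
open import Data.Product using (Σ; ∃; _×_; _,_)
open import Relation.Binary.PropositionalEquality using (_≡_)
open import Relation.Nullary using (¬_)

_△_ : ∀ {n} → Subset n → Subset n → Subset n
A △ B = (A ─ B) ∪ (B ─ A)

infixl 5 _△_

record Matroid (n : ℕ) : Set where
  field
    isBasis  : Subset n → Bool
    nonempty : ∃ λ B → isBasis B ≡ true
    exchange : ∀ B₁ B₂ → isBasis B₁ ≡ true → isBasis B₂ ≡ true →
               ∀ x → x ∈ B₁ → x ∉ B₂ →
               ∃ λ y → y ∈ B₂ × y ∉ B₁ × isBasis ((B₁ - x) ∪ ⁅ y ⁆) ≡ true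

open Matroid public

IsBasis : ∀ {n} → Matroid n → Subset n → Set
IsBasis M B = isBasis M B ≡ true

HasRank : ∀ {n} → Matroid n → ℕ → Set
HasRank M r = ∀ B → IsBasis M B → ∣ B ∣ ≡ r

Independent : ∀ {n} → Matroid n → Subset n → Set
Independent M I = ∃ λ B → IsBasis M B × I ⊆ B

Dependent : ∀ {n} → Matroid n → Subset n → Set
Dependent M D = ¬ Independent M D

IsCircuit : ∀ {n} → Matroid n → Subset n → Set
IsCircuit M C = Dependent M C × (∀ D → D ⊂ C → Independent M D)

IsUnionOfCircuits : ∀ {n} → Matroid n → Subset n → Set
IsUnionOfCircuits M C = ∀ x → x ∈ C → ∃ λ C' → IsCircuit M C' × C' ⊆ C × x ∈ C'

IsQuotient : ∀ {n} → Matroid n → Matroid n → Set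
IsQuotient M₁ M₂ = ∀ C → IsCircuit M₁ C → IsUnionOfCircuits M₂ C

IsElementaryQuotient : ∀ {n} → Matroid n → Matroid n → Set
IsElementaryQuotient M₁ M₂ =
  IsQuotient M₁ M₂ × (∃ λ r → HasRank M₁ (suc r) × HasRank M₂ r)

-- A quotient only enlarges closures: whatever M₁ spans, M₂ spans, so M₂-independent sets are
-- M₁-independent and an M₂-basis of an M₁-basis of X is an M₂-basis of X. As the ranks differ
-- by one, every M₁-basis is an M₂-basis plus one element. For (b), the M₂-circuit C inside an
-- M₁-basis B₁ is M₁-independent, so some i ∈ C augments B₂ in M₁, while B₁ - i stays
-- M₂-independent. For (a) with i ∈ B₂ ∖ B₁, the M₁-fundamental circuit of i in B₁ contains an
-- M₂-circuit through i, which supplies j; with i ∈ B₁ ∖ B₂, either an element j of the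
-- M₂-fundamental circuit C of i in B₂ can replace i in B₁, or B₁ - i spans C - i in M₁ and case (1)
-- holds. The converse uses (a) alone: if x were not M₂-spanned by C - x for an M₁-circuit C,
-- then (a) at x for bases B₁ ⊇ C - x and B₂ ⊇ J ∪ {x}, J an M₂-basis of C - x, can only give
-- case (2) with some j ∈ (C - x) ∖ J for which J ∪ {j} is M₂-independent, contradicting the
-- maximality of J.

module Submission where

open import Defs
open import Data.Bool using (true) renaming (_≟_ to _≟ᵇ_)
open import Data.Fin using (Fin; zero; suc; _≟_)
open import Data.Fin.Properties using (any?)
open import Data.Fin.Subset
open import Data.Fin.Subset.Properties
open import Data.Nat using (ℕ; suc; _+_; _≤_; _<_)
open import Data.Nat.Properties
  using ( suc-injective; ≤-trans; ≤-<-trans; ≤-reflexive; <-≤-trans; ≤-pred; <⇒≱; n<1+n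
        ; +-comm; +-suc; +-monoʳ-≤; +-cancelʳ-≤; module ≤-Reasoning)
open import Data.Vec using ([]; _∷_; here; there)
open import Data.Product using (∃; _×_; _,_; proj₁)
open import Data.Sum using (_⊎_; inj₁; inj₂; [_,_]′)
open import Function.Base using (_∘_)
open import Function.Bundles using (_⇔_; mk⇔)
open import Relation.Nullary using (¬_; Dec; yes; no; ¬?; contradiction)
open import Relation.Nullary.Decidable using (_×-dec_; decidable-stable)
open import Relation.Binary.PropositionalEquality
  using (_≡_; _≢_; refl; sym; trans; cong; subst; module ≡-Reasoning)

private
  variable
    n : ℕ
    p q s : Subset n
    x y : Fin n

x∈p─q⇒x∉q : ∀ (p q : Subset n) → x ∈ p ─ q → x ∉ q
x∈p─q⇒x∉q (_ ∷ _) (inside ∷ _) () here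
x∈p─q⇒x∉q (_ ∷ p) (_ ∷ q) (there x∈p─q) (there x∈q) = x∈p─q⇒x∉q p q x∈p─q x∈q

x∈p-y⇒x≢y : ∀ (p : Subset n) → x ∈ p - y → x ≢ y
x∈p-y⇒x≢y {y = y} p x∈p-y refl = x∈p─q⇒x∉q p ⁅ y ⁆ x∈p-y (x∈⁅x⁆ y)

x∈p∪q∧x∉p⇒x∈q : ∀ (p q : Subset n) → x ∈ p ∪ q → x ∉ p → x ∈ q
x∈p∪q∧x∉p⇒x∈q p q x∈p∪q x∉p with x∈p∪q⁻ p q x∈p∪q
... | inj₁ x∈p = contradiction x∈p x∉p
... | inj₂ x∈q = x∈q

x∈p∪⁅y⁆∧x≢y⇒x∈p : ∀ (p : Subset n) → x ∈ p ∪ ⁅ y ⁆ → x ≢ y → x ∈ p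
x∈p∪⁅y⁆∧x≢y⇒x∈p {y = y} p x∈ x≢y with x∈p∪q⁻ p ⁅ y ⁆ x∈
... | inj₁ x∈p = x∈p
... | inj₂ x∈⁅y⁆ = contradiction (x∈⁅y⁆⇒x≡y y x∈⁅y⁆) x≢y

x∈p△q⁻ : ∀ (p q : Subset n) → x ∈ p △ q → (x ∈ p × x ∉ q) ⊎ (x ∈ q × x ∉ p)
x∈p△q⁻ p q x∈ with x∈p∪q⁻ (p ─ q) (q ─ p) x∈
... | inj₁ x∈p─q = inj₁ (p─q⊆p p q x∈p─q , x∈p─q⇒x∉q p q x∈p─q)
... | inj₂ x∈q─p = inj₂ (p─q⊆p q p x∈q─p , x∈p─q⇒x∉q q p x∈q─p)

x∈p△q⁺ˡ : x ∈ p → x ∉ q → x ∈ p △ q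
x∈p△q⁺ˡ x∈p x∉q = x∈p∪q⁺ (inj₁ (x∈p∧x∉q⇒x∈p─q x∈p x∉q))

x∈p△q⁺ʳ : x ∈ q → x ∉ p → x ∈ p △ q
x∈p△q⁺ʳ x∈q x∉p = x∈p∪q⁺ (inj₂ (x∈p∧x∉q⇒x∈p─q x∈q x∉p))

∪-⊆ : p ⊆ s → q ⊆ s → p ∪ q ⊆ s
∪-⊆ {p = p} {q = q} p⊆s q⊆s x∈ = [ p⊆s , q⊆s ]′ (x∈p∪q⁻ p q x∈)

∪-monoˡ-⊆ : ∀ (s : Subset n) → p ⊆ q → p ∪ s ⊆ q ∪ s
∪-monoˡ-⊆ {q = q} s p⊆q = ∪-⊆ (⊆-trans p⊆q (p⊆p∪q s)) (q⊆p∪q q s)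

x∈p⇒⁅x⁆⊆p : x ∈ p → ⁅ x ⁆ ⊆ p
x∈p⇒⁅x⁆⊆p {x = x} x∈p y∈⁅x⁆ rewrite x∈⁅y⁆⇒x≡y x y∈⁅x⁆ = x∈p

p⊆p-x∪⁅x⁆ : ∀ (p : Subset n) x → p ⊆ (p - x) ∪ ⁅ x ⁆
p⊆p-x∪⁅x⁆ p x {y} y∈p with y ≟ x
... | yes refl = q⊆p∪q (p - x) ⁅ x ⁆ (x∈⁅x⁆ x)
... | no y≢x = p⊆p∪q ⁅ x ⁆ (x∈p∧x≢y⇒x∈p-y y∈p y≢x)

p⊆q⇒p-x⊆q-x : ∀ (p : Subset n) x → p ⊆ q → p - x ⊆ q - x
p⊆q⇒p-x⊆q-x p x p⊆q y∈ = x∈p∧x≢y⇒x∈p-y (p⊆q (p─q⊆p p ⁅ x ⁆ y∈)) (x∈p-y⇒x≢y p y∈)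

p⊆q∪⁅x⁆⇒p-x⊆q : ∀ (p q : Subset n) x → p ⊆ q ∪ ⁅ x ⁆ → p - x ⊆ q
p⊆q∪⁅x⁆⇒p-x⊆q p q x p⊆ y∈ = x∈p∪⁅y⁆∧x≢y⇒x∈p q (p⊆ (p─q⊆p p ⁅ x ⁆ y∈)) (x∈p-y⇒x≢y p y∈)

p⊆q∪⁅x⁆∧x∉p⇒p⊆q : ∀ (q : Subset n) → p ⊆ q ∪ ⁅ x ⁆ → x ∉ p → p ⊆ q
p⊆q∪⁅x⁆∧x∉p⇒p⊆q q p⊆ x∉p y∈p = x∈p∪⁅y⁆∧x≢y⇒x∈p q (p⊆ y∈p) λ { refl → x∉p y∈p }

p⊆q∪⁅x⁆∧y∉p⇒p⊆q-y∪⁅x⁆ : ∀ (q : Subset n) → p ⊆ q ∪ ⁅ x ⁆ → y ∉ p → p ⊆ (q - y) ∪ ⁅ x ⁆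
p⊆q∪⁅x⁆∧y∉p⇒p⊆q-y∪⁅x⁆ {x = x} q p⊆ y∉p {z} z∈p with x∈p∪q⁻ q ⁅ x ⁆ (p⊆ z∈p)
... | inj₁ z∈q = p⊆p∪q ⁅ x ⁆ (x∈p∧x≢y⇒x∈p-y z∈q λ { refl → y∉p z∈p })
... | inj₂ z∈⁅x⁆ = q⊆p∪q (q - _) ⁅ x ⁆ z∈⁅x⁆

p⊈q⇒∃x∈p∧x∉q : ¬ (p ⊆ q) → ∃ λ x → x ∈ p × x ∉ q
p⊈q⇒∃x∈p∧x∉q {p = p} {q = q} p⊈q = decidable-stable (any? λ x → (x ∈? p) ×-dec ¬? (x ∈? q)) λ none →
  p⊈q λ {x} x∈p → decidable-stable (x ∈? q) λ x∉q → none (x , x∈p , x∉q)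

p⊆q∧∣q∣≤∣p∣⇒q⊆p : p ⊆ q → ∣ q ∣ ≤ ∣ p ∣ → q ⊆ p
p⊆q∧∣q∣≤∣p∣⇒q⊆p {p = p} p⊆q ∣q∣≤∣p∣ {x} x∈q =
  decidable-stable (x ∈? p) λ x∉p → <⇒≱ (p⊂q⇒∣p∣<∣q∣ (p⊆q , x , x∈q , x∉p)) ∣q∣≤∣p∣

∣p∪q∣≡∣p∣+∣q─p∣ : ∀ (p q : Subset n) → ∣ p ∪ q ∣ ≡ ∣ p ∣ + ∣ q ─ p ∣
∣p∪q∣≡∣p∣+∣q─p∣ [] [] = refl
∣p∪q∣≡∣p∣+∣q─p∣ (inside ∷ p) (_ ∷ q) = cong suc (∣p∪q∣≡∣p∣+∣q─p∣ p q)
∣p∪q∣≡∣p∣+∣q─p∣ (outside ∷ p) (inside ∷ q) =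
  trans (cong suc (∣p∪q∣≡∣p∣+∣q─p∣ p q)) (sym (+-suc ∣ p ∣ ∣ q ─ p ∣))
∣p∪q∣≡∣p∣+∣q─p∣ (outside ∷ p) (outside ∷ q) = ∣p∪q∣≡∣p∣+∣q─p∣ p q

∣p∪⁅x⁆∣≡1+∣p∣ : ∀ (p : Subset n) x → x ∉ p → ∣ p ∪ ⁅ x ⁆ ∣ ≡ suc ∣ p ∣
∣p∪⁅x⁆∣≡1+∣p∣ p x x∉p = begin
  ∣ p ∪ ⁅ x ⁆ ∣        ≡⟨ ∣p∪q∣≡∣p∣+∣q─p∣ p ⁅ x ⁆ ⟩
  ∣ p ∣ + ∣ ⁅ x ⁆ ─ p ∣ ≡⟨ cong (λ s → ∣ p ∣ + ∣ s ∣) ⁅x⁆─p≡⁅x⁆ ⟩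
  ∣ p ∣ + ∣ ⁅ x ⁆ ∣     ≡⟨ cong (∣ p ∣ +_) (∣⁅x⁆∣≡1 x) ⟩
  ∣ p ∣ + 1            ≡⟨ +-comm ∣ p ∣ 1 ⟩
  suc ∣ p ∣            ∎
  where
  open ≡-Reasoning
  ⁅x⁆─p≡⁅x⁆ : ⁅ x ⁆ ─ p ≡ ⁅ x ⁆
  ⁅x⁆─p≡⁅x⁆ = ⊆-antisym (p─q⊆p ⁅ x ⁆ p)
    (λ y∈⁅x⁆ → x∈p∧x∉q⇒x∈p─q y∈⁅x⁆ (subst (_∉ p) (sym (x∈⁅y⁆⇒x≡y x y∈⁅x⁆)) x∉p))

1+∣p-x∣≡∣p∣ : ∀ (p : Subset n) x → x ∈ p → suc ∣ p - x ∣ ≡ ∣ p ∣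
1+∣p-x∣≡∣p∣ (inside ∷ p) zero here = cong (λ s → suc ∣ s ∣) (p─⊥≡p p)
1+∣p-x∣≡∣p∣ (inside ∷ p) (suc x) (there x∈p) = cong suc (1+∣p-x∣≡∣p∣ p x x∈p)
1+∣p-x∣≡∣p∣ (outside ∷ p) (suc x) (there x∈p) = 1+∣p-x∣≡∣p∣ p x x∈p

∣p∪⁅x⁆∣≤1+∣p∣ : ∀ (p : Subset n) x → ∣ p ∪ ⁅ x ⁆ ∣ ≤ suc ∣ p ∣
∣p∪⁅x⁆∣≤1+∣p∣ p x = begin
  ∣ p ∪ ⁅ x ⁆ ∣        ≡⟨ ∣p∪q∣≡∣p∣+∣q─p∣ p ⁅ x ⁆ ⟩
  ∣ p ∣ + ∣ ⁅ x ⁆ ─ p ∣ ≤⟨ +-monoʳ-≤ ∣ p ∣ (∣p─q∣≤∣p∣ ⁅ x ⁆ p) ⟩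
  ∣ p ∣ + ∣ ⁅ x ⁆ ∣     ≡⟨ cong (∣ p ∣ +_) (∣⁅x⁆∣≡1 x) ⟩
  ∣ p ∣ + 1            ≡⟨ +-comm ∣ p ∣ 1 ⟩
  suc ∣ p ∣            ∎
  where open ≤-Reasoning

∣p-x∪⁅y⁆∣≡∣p∣ : ∀ (p : Subset n) → x ∈ p → y ∉ p → ∣ (p - x) ∪ ⁅ y ⁆ ∣ ≡ ∣ p ∣
∣p-x∪⁅y⁆∣≡∣p∣ {x = x} {y = y} p x∈p y∉p =
  trans (∣p∪⁅x⁆∣≡1+∣p∣ (p - x) y (y∉p ∘ p─q⊆p p ⁅ x ⁆)) (1+∣p-x∣≡∣p∣ p x x∈p)

p△⁅x⁆≡p-x : ∀ (p : Subset n) → x ∈ p → p △ ⁅ x ⁆ ≡ p - x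
p△⁅x⁆≡p-x {x = x} p x∈p = ⊆-antisym △⊆ (p⊆p∪q (⁅ x ⁆ ─ p))
  where
  △⊆ : p △ ⁅ x ⁆ ⊆ p - x
  △⊆ y∈ with x∈p△q⁻ p ⁅ x ⁆ y∈
  ... | inj₁ (y∈p , y∉⁅x⁆) = x∈p∧x∉q⇒x∈p─q y∈p y∉⁅x⁆
  ... | inj₂ (y∈⁅x⁆ , y∉p) = contradiction (subst (_∈ p) (sym (x∈⁅y⁆⇒x≡y x y∈⁅x⁆)) x∈p) y∉p

p△⁅x⁆≡p∪⁅x⁆ : ∀ (p : Subset n) → x ∉ p → p △ ⁅ x ⁆ ≡ p ∪ ⁅ x ⁆
p△⁅x⁆≡p∪⁅x⁆ {x = x} p x∉p = ⊆-antisym △⊆ ⊆△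
  where
  △⊆ : p △ ⁅ x ⁆ ⊆ p ∪ ⁅ x ⁆
  △⊆ y∈ with x∈p△q⁻ p ⁅ x ⁆ y∈
  ... | inj₁ (y∈p , _) = p⊆p∪q ⁅ x ⁆ y∈p
  ... | inj₂ (y∈⁅x⁆ , _) = q⊆p∪q p ⁅ x ⁆ y∈⁅x⁆
  ⊆△ : p ∪ ⁅ x ⁆ ⊆ p △ ⁅ x ⁆
  ⊆△ y∈ with x∈p∪q⁻ p ⁅ x ⁆ y∈
  ... | inj₁ y∈p = x∈p△q⁺ˡ y∈p λ y∈⁅x⁆ → x∉p (subst (_∈ p) (x∈⁅y⁆⇒x≡y x y∈⁅x⁆) y∈p)
  ... | inj₂ y∈⁅x⁆ = x∈p△q⁺ʳ y∈⁅x⁆ λ y∈p → x∉p (subst (_∈ p) (x∈⁅y⁆⇒x≡y x y∈⁅x⁆) y∈p)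

x∈⁅y⁆∪⁅z⁆⁻ : ∀ (y z : Fin n) → x ∈ ⁅ y ⁆ ∪ ⁅ z ⁆ → x ≡ y ⊎ x ≡ z
x∈⁅y⁆∪⁅z⁆⁻ y z x∈ with x∈p∪q⁻ ⁅ y ⁆ ⁅ z ⁆ x∈
... | inj₁ x∈⁅y⁆ = inj₁ (x∈⁅y⁆⇒x≡y y x∈⁅y⁆)
... | inj₂ x∈⁅z⁆ = inj₂ (x∈⁅y⁆⇒x≡y z x∈⁅z⁆)

p△⁅x⁆∪⁅y⁆≡p-x∪⁅y⁆ : ∀ (p : Subset n) → x ∈ p → y ∉ p → p △ (⁅ x ⁆ ∪ ⁅ y ⁆) ≡ (p - x) ∪ ⁅ y ⁆
p△⁅x⁆∪⁅y⁆≡p-x∪⁅y⁆ {x = x} {y = y} p x∈p y∉p = ⊆-antisym △⊆ ⊆△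
  where
  △⊆ : p △ (⁅ x ⁆ ∪ ⁅ y ⁆) ⊆ (p - x) ∪ ⁅ y ⁆
  △⊆ z∈ with x∈p△q⁻ p (⁅ x ⁆ ∪ ⁅ y ⁆) z∈
  ... | inj₁ (z∈p , z∉xy) = p⊆p∪q ⁅ y ⁆ (x∈p∧x≢y⇒x∈p-y z∈p λ { refl → z∉xy (p⊆p∪q ⁅ y ⁆ (x∈⁅x⁆ x)) })
  ... | inj₂ (z∈xy , z∉p) with x∈⁅y⁆∪⁅z⁆⁻ x y z∈xy
  ...   | inj₁ refl = contradiction x∈p z∉p
  ...   | inj₂ refl = q⊆p∪q (p - x) ⁅ y ⁆ (x∈⁅x⁆ y)
  ⊆△ : (p - x) ∪ ⁅ y ⁆ ⊆ p △ (⁅ x ⁆ ∪ ⁅ y ⁆)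
  ⊆△ {z} z∈ with x∈p∪q⁻ (p - x) ⁅ y ⁆ z∈
  ... | inj₂ z∈⁅y⁆ rewrite x∈⁅y⁆⇒x≡y y z∈⁅y⁆ = x∈p△q⁺ʳ (q⊆p∪q ⁅ x ⁆ ⁅ y ⁆ (x∈⁅x⁆ y)) y∉p
  ... | inj₁ z∈p-x = x∈p△q⁺ˡ (p─q⊆p p ⁅ x ⁆ z∈p-x) z∉xy
    where
    z∉xy : z ∉ ⁅ x ⁆ ∪ ⁅ y ⁆
    z∉xy z∈xy with x∈⁅y⁆∪⁅z⁆⁻ x y z∈xy
    ... | inj₁ refl = x∈p-y⇒x≢y p z∈p-x refl
    ... | inj₂ refl = y∉p (p─q⊆p p ⁅ x ⁆ z∈p-x)

p△⁅x⁆∪⁅y⁆≡p-y∪⁅x⁆ : ∀ (p : Subset n) → y ∈ p → x ∉ p → p △ (⁅ x ⁆ ∪ ⁅ y ⁆) ≡ (p - y) ∪ ⁅ x ⁆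
p△⁅x⁆∪⁅y⁆≡p-y∪⁅x⁆ {y = y} {x = x} p y∈p x∉p =
  trans (cong (p △_) (∪-comm ⁅ x ⁆ ⁅ y ⁆)) (p△⁅x⁆∪⁅y⁆≡p-x∪⁅y⁆ p y∈p x∉p)

p∪⁅x⁆⊆p△⁅x⁆∪⁅y⁆ : ∀ (p : Subset n) → x ∉ p → y ∉ p → p ∪ ⁅ x ⁆ ⊆ p △ (⁅ x ⁆ ∪ ⁅ y ⁆)
p∪⁅x⁆⊆p△⁅x⁆∪⁅y⁆ {x = x} {y = y} p x∉p y∉p {z} z∈ with x∈p∪q⁻ p ⁅ x ⁆ z∈
... | inj₂ z∈⁅x⁆ = x∈p△q⁺ʳ (p⊆p∪q ⁅ y ⁆ z∈⁅x⁆) (λ z∈p → x∉p (subst (_∈ p) (x∈⁅y⁆⇒x≡y x z∈⁅x⁆) z∈p))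
... | inj₁ z∈p = x∈p△q⁺ˡ z∈p z∉xy
  where
  z∉xy : z ∉ ⁅ x ⁆ ∪ ⁅ y ⁆
  z∉xy z∈xy with x∈⁅y⁆∪⁅z⁆⁻ x y z∈xy
  ... | inj₁ refl = x∉p z∈p
  ... | inj₂ refl = y∉p z∈p

module MatroidProperties {n : ℕ} (M : Matroid n) where

  private
    variable
      B C D I J K X Y : Subset n

  -- x lies in the closure of X ∖ {x}.
  Spans : Subset n → Fin n → Set
  Spans X x = ∃ λ K → K ⊆ X × Independent M K × Dependent M (K ∪ ⁅ x ⁆)

  record IsBasisOf (J X : Subset n) : Set where
    field
      subset      : J ⊆ X
      independent : Independent M J
      maximal     : ∀ {y} → y ∈ X → Independent M (J ∪ ⁅ y ⁆) → y ∈ J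

  open IsBasisOf public

  independent? : ∀ I → Dec (Independent M I)
  independent? I = anySubset? λ B → (isBasis M B ≟ᵇ true) ×-dec (I ⊆? B)

  independent-⊆ : I ⊆ J → Independent M J → Independent M I
  independent-⊆ I⊆J (B , b , J⊆B) = B , b , ⊆-trans I⊆J J⊆B

  basis⇒independent : IsBasis M B → Independent M B
  basis⇒independent {B = B} b = B , b , ⊆-refl

  ⊥-independent : Independent M ⊥
  ⊥-independent with nonempty M
  ... | B , b = B , b , ⊆-min B

  dependent-⊆-insert⇒∈ : Independent M I → D ⊆ I ∪ ⁅ x ⁆ → Dependent M D → x ∈ D
  dependent-⊆-insert⇒∈ {I = I} {D = D} {x = x} iI D⊆ dD =
    decidable-stable (x ∈? D) λ x∉D → dD (independent-⊆ (p⊆q∪⁅x⁆∧x∉p⇒p⊆q I D⊆ x∉D) iI)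

  circuit-delete : IsCircuit M C → x ∈ C → Independent M (C - x)
  circuit-delete (_ , minimal) x∈C = minimal _ (x∈p⇒p-x⊂p x∈C)

  circuit-nonempty : IsCircuit M C → Nonempty C
  circuit-nonempty {C = C} (dC , _) = decidable-stable (nonempty? C) λ empty →
    dC (independent-⊆ (λ x∈C → contradiction (_ , x∈C) empty) ⊥-independent)

  dependent⇒⊇circuit : Dependent M D → ∃ λ C → C ⊆ D × IsCircuit M C
  dependent⇒⊇circuit {D = D} = go (suc ∣ D ∣) D (n<1+n ∣ D ∣)
    where
    go : ∀ fuel D → ∣ D ∣ < fuel → Dependent M D → ∃ λ C → C ⊆ D × IsCircuit M C
    go (suc fuel) D ∣D∣<fuel dD with any? (λ x → (x ∈? D) ×-dec ¬? (independent? (D - x)))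
    ... | yes (x , x∈D , dD-x) with go fuel (D - x) (<-≤-trans (x∈p⇒∣p-x∣<∣p∣ x∈D) (≤-pred ∣D∣<fuel)) dD-x
    ...   | C , C⊆D-x , c = C , ⊆-trans C⊆D-x (p─q⊆p D ⁅ x ⁆) , c
    go (suc fuel) D ∣D∣<fuel dD | no none = D , ⊆-refl , dD , minimal
      where
      minimal : ∀ E → E ⊂ D → Independent M E
      minimal E (E⊆D , x , x∈D , x∉E) =
        independent-⊆ (λ y∈E → x∈p∧x≢y⇒x∈p-y (E⊆D y∈E) λ { refl → x∉E y∈E })
          (decidable-stable (independent? (D - x)) λ dD-x → none (x , x∈D , dD-x))

  spans-⊆ : X ⊆ Y → Spans X x → Spans Y x
  spans-⊆ X⊆Y (K , K⊆X , iK , dKx) = K , ⊆-trans K⊆X X⊆Y , iK , dKx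

  circuit⇒spans : IsCircuit M C → x ∈ C → Spans (C - x) x
  circuit⇒spans {C = C} {x = x} c x∈C =
    C - x , ⊆-refl , circuit-delete c x∈C , λ iCx → proj₁ c (independent-⊆ (p⊆p-x∪⁅x⁆ C x) iCx)

  circuit-delete-⊆⇒∉ : IsCircuit M C → Independent M I → C - x ⊆ I → x ∉ I
  circuit-delete-⊆⇒∉ {C = C} {x = x} c iI C-x⊆I x∈I =
    proj₁ c (independent-⊆ (⊆-trans (p⊆p-x∪⁅x⁆ C x) (∪-⊆ C-x⊆I (x∈p⇒⁅x⁆⊆p x∈I))) iI)

  spans⇒circuit : Spans X x → ∃ λ C → IsCircuit M C × C ⊆ X ∪ ⁅ x ⁆ × x ∈ C
  spans⇒circuit {x = x} (K , K⊆X , iK , dKx) with dependent⇒⊇circuit dKx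
  ... | C , C⊆Kx , c = C , c , ⊆-trans C⊆Kx (∪-monoˡ-⊆ ⁅ x ⁆ K⊆X) , dependent-⊆-insert⇒∈ iK C⊆Kx (proj₁ c)

  ¬spans⇒insert-independent : Independent M K → ¬ Spans K x → Independent M (K ∪ ⁅ x ⁆)
  ¬spans⇒insert-independent {K = K} {x = x} iK ¬spans =
    decidable-stable (independent? (K ∪ ⁅ x ⁆)) λ dKx → ¬spans (K , ⊆-refl , iK , dKx)

  isBasisOf⇒spans : IsBasisOf J X → y ∈ X → y ∉ J → Spans J y
  isBasisOf⇒spans hJ y∈X y∉J = _ , ⊆-refl , independent hJ , λ iJy → y∉J (maximal hJ y∈X iJy)

  augment⊎isBasisOf : Independent M I → I ⊆ X →
    (∃ λ y → y ∈ X × y ∉ I × Independent M (I ∪ ⁅ y ⁆)) ⊎ IsBasisOf I X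
  augment⊎isBasisOf {I = I} {X = X} iI I⊆X
    with any? (λ y → (y ∈? X) ×-dec ¬? (y ∈? I) ×-dec independent? (I ∪ ⁅ y ⁆))
  ... | yes augment = inj₁ augment
  ... | no none = inj₂ record
    { subset      = I⊆X
    ; independent = iI
    ; maximal     = λ {y} y∈X iIy → decidable-stable (y ∈? I) λ y∉I → none (y , y∈X , y∉I , iIy)
    }

  extend-to-isBasisOf : Independent M I → I ⊆ X → ∃ λ J → I ⊆ J × IsBasisOf J X
  extend-to-isBasisOf {I = I} {X = X} = go (suc ∣ X ─ I ∣) I (n<1+n ∣ X ─ I ∣)
    where
    go : ∀ fuel I → ∣ X ─ I ∣ < fuel → Independent M I → I ⊆ X → ∃ λ J → I ⊆ J × IsBasisOf J X
    go (suc fuel) I ∣X─I∣<fuel iI I⊆X with augment⊎isBasisOf iI I⊆X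
    ... | inj₂ hI = I , ⊆-refl , hI
    ... | inj₁ (y , y∈X , y∉I , iIy) with go fuel (I ∪ ⁅ y ⁆) shrinks iIy (∪-⊆ I⊆X (x∈p⇒⁅x⁆⊆p y∈X))
      where
      shrinks : ∣ X ─ (I ∪ ⁅ y ⁆) ∣ < fuel
      shrinks = <-≤-trans
        (subst (_< ∣ X ─ I ∣) (cong ∣_∣ (p─q─r≡p─q∪r X I ⁅ y ⁆)) (x∈p⇒∣p-x∣<∣p∣ (x∈p∧x∉q⇒x∈p─q y∈X y∉I)))
        (≤-pred ∣X─I∣<fuel)
    ...   | J , Iy⊆J , hJ = J , ⊆-trans (p⊆p∪q ⁅ y ⁆) Iy⊆J , hJ

  isBasisOf-exists : ∀ X → ∃ λ J → IsBasisOf J X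
  isBasisOf-exists X with extend-to-isBasisOf ⊥-independent (⊆-min X)
  ... | J , _ , hJ = J , hJ

  basis-between : Independent M I → IsBasis M B → ∃ λ B′ → IsBasis M B′ × I ⊆ B′ × B′ ⊆ I ∪ B
  basis-between {I = I} {B = B} (B₀ , b₀ , I⊆B₀) b = go (suc ∣ B₀ ─ (I ∪ B) ∣) B₀ (n<1+n _) b₀ I⊆B₀
    where
    go : ∀ fuel B₀ → ∣ B₀ ─ (I ∪ B) ∣ < fuel → IsBasis M B₀ → I ⊆ B₀ →
         ∃ λ B′ → IsBasis M B′ × I ⊆ B′ × B′ ⊆ I ∪ B
    go (suc fuel) B₀ bound b₀ I⊆B₀ with any? (λ x → (x ∈? B₀) ×-dec ¬? (x ∈? (I ∪ B)))
    ... | no none = B₀ , b₀ , I⊆B₀ , λ {x} x∈B₀ → decidable-stable (x ∈? (I ∪ B)) λ x∉ → none (x , x∈B₀ , x∉)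
    ... | yes (x , x∈B₀ , x∉I∪B) with exchange M B₀ B b₀ b x x∈B₀ (x∉I∪B ∘ q⊆p∪q I B)
    ...   | y , y∈B , y∉B₀ , b₁ = go fuel ((B₀ - x) ∪ ⁅ y ⁆) shrinks b₁ I⊆B₁
      where
      I⊆B₁ : I ⊆ (B₀ - x) ∪ ⁅ y ⁆
      I⊆B₁ z∈I = p⊆p∪q ⁅ y ⁆ (x∈p∧x≢y⇒x∈p-y (I⊆B₀ z∈I) λ { refl → x∉I∪B (p⊆p∪q B z∈I) })
      B₁─⊆ : ((B₀ - x) ∪ ⁅ y ⁆) ─ (I ∪ B) ⊆ (B₀ ─ (I ∪ B)) - x
      B₁─⊆ z∈ with x∈p∪q⁻ (B₀ - x) ⁅ y ⁆ (p─q⊆p _ (I ∪ B) z∈)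
      ... | inj₁ z∈B₀-x = x∈p∧x≢y⇒x∈p-y
              (x∈p∧x∉q⇒x∈p─q (p─q⊆p B₀ ⁅ x ⁆ z∈B₀-x) (x∈p─q⇒x∉q _ (I ∪ B) z∈)) (x∈p-y⇒x≢y B₀ z∈B₀-x)
      ... | inj₂ z∈⁅y⁆ rewrite x∈⁅y⁆⇒x≡y y z∈⁅y⁆ = contradiction (q⊆p∪q I B y∈B) (x∈p─q⇒x∉q _ (I ∪ B) z∈)
      shrinks : ∣ ((B₀ - x) ∪ ⁅ y ⁆) ─ (I ∪ B) ∣ < fuel
      shrinks = <-≤-trans
        (≤-<-trans (p⊆q⇒∣p∣≤∣q∣ B₁─⊆) (x∈p⇒∣p-x∣<∣p∣ (x∈p∧x∉q⇒x∈p─q x∈B₀ x∉I∪B))) (≤-pred bound)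

module RankedMatroid {n : ℕ} (M : Matroid n) {r : ℕ} (rank : HasRank M r) where

  open MatroidProperties M public

  private
    variable
      B C D I J K S X Y : Subset n

  -- Opaque because unfolding these proofs (the ≤-derivations in particular) while checking
  -- later lemmas exhausts memory.
  opaque

    ∣independent∣≤r : Independent M I → ∣ I ∣ ≤ r
    ∣independent∣≤r (B , b , I⊆B) = ≤-trans (p⊆q⇒∣p∣≤∣q∣ I⊆B) (≤-reflexive (rank B b))

    r<∣∣⇒dependent : r < ∣ D ∣ → Dependent M D
    r<∣∣⇒dependent r<∣D∣ iD = <⇒≱ r<∣D∣ (∣independent∣≤r iD)

    independent∧r≤∣∣⇒basis : Independent M S → r ≤ ∣ S ∣ → IsBasis M S
    independent∧r≤∣∣⇒basis (B , b , S⊆B) r≤∣S∣ =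
      subst (IsBasis M) (⊆-antisym (p⊆q∧∣q∣≤∣p∣⇒q⊆p S⊆B (≤-trans (≤-reflexive (rank B b)) r≤∣S∣)) S⊆B) b

    independent∧∣∣≡r⇒basis : Independent M S → ∣ S ∣ ≡ r → IsBasis M S
    independent∧∣∣≡r⇒basis iS ∣S∣≡r = independent∧r≤∣∣⇒basis iS (≤-reflexive (sym ∣S∣≡r))

    basis-insert-dependent : IsBasis M B → x ∉ B → Dependent M (B ∪ ⁅ x ⁆)
    basis-insert-dependent {B = B} {x = x} b x∉B =
      r<∣∣⇒dependent (≤-reflexive (sym (trans (∣p∪⁅x⁆∣≡1+∣p∣ B x x∉B) (cong suc (rank B b)))))

    fundamental-circuit : IsBasis M B → x ∉ B → ∃ λ C → C ⊆ B ∪ ⁅ x ⁆ × IsCircuit M C × x ∈ C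
    fundamental-circuit {B = B} b x∉B
      with spans⇒circuit (B , ⊆-refl , basis⇒independent b , basis-insert-dependent b x∉B)
    ... | C , c , C⊆Bx , x∈C = C , C⊆Bx , c , x∈C

    isBasisOf-∪-maximum : IsBasisOf I (I ∪ J) → Independent M J → ∣ J ∣ ≤ ∣ I ∣
    isBasisOf-∪-maximum {I = I} {J = J} hI (BJ , bJ , J⊆BJ) with basis-between (independent hI) bJ
    ... | B′ , b′ , I⊆B′ , B′⊆I∪BJ = +-cancelʳ-≤ (∣ Z ─ J ∣) (∣ J ∣) (∣ I ∣) (begin
      ∣ J ∣ + ∣ Z ─ J ∣ ≡⟨ sym (∣p∪q∣≡∣p∣+∣q─p∣ J Z) ⟩
      ∣ J ∪ Z ∣        ≤⟨ p⊆q⇒∣p∣≤∣q∣ (∪-⊆ J⊆BJ (p∩q⊆q B′ BJ)) ⟩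
      ∣ BJ ∣           ≡⟨ trans (rank BJ bJ) (sym (rank B′ b′)) ⟩
      ∣ B′ ∣           ≤⟨ p⊆q⇒∣p∣≤∣q∣ B′⊆I∪Z ⟩
      ∣ I ∪ Z ∣        ≡⟨ ∣p∪q∣≡∣p∣+∣q─p∣ I Z ⟩
      ∣ I ∣ + ∣ Z ─ I ∣ ≤⟨ +-monoʳ-≤ ∣ I ∣ (p⊆q⇒∣p∣≤∣q∣ Z─I⊆Z─J) ⟩
      ∣ I ∣ + ∣ Z ─ J ∣ ∎)
      where
      open ≤-Reasoning
      Z : Subset n
      Z = B′ ∩ BJ
      B′⊆I∪Z : B′ ⊆ I ∪ Z
      B′⊆I∪Z z∈B′ with x∈p∪q⁻ I BJ (B′⊆I∪BJ z∈B′)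
      ... | inj₁ z∈I = p⊆p∪q Z z∈I
      ... | inj₂ z∈BJ = q⊆p∪q I Z (x∈p∩q⁺ (z∈B′ , z∈BJ))
      Z─I⊆Z─J : Z ─ I ⊆ Z ─ J
      Z─I⊆Z─J {z} z∈Z─I = x∈p∧x∉q⇒x∈p─q z∈Z λ z∈J →
        x∈p─q⇒x∉q Z I z∈Z─I (maximal hI (q⊆p∪q I J z∈J) (independent-⊆ Iz⊆B′ (basis⇒independent b′)))
        where
        z∈Z : z ∈ Z
        z∈Z = p─q⊆p Z I z∈Z─I
        Iz⊆B′ : I ∪ ⁅ z ⁆ ⊆ B′
        Iz⊆B′ = ∪-⊆ I⊆B′ (x∈p⇒⁅x⁆⊆p (proj₁ (x∈p∩q⁻ B′ BJ z∈Z)))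

    isBasisOf-maximum : IsBasisOf J X → Independent M K → K ⊆ X → ∣ K ∣ ≤ ∣ J ∣
    isBasisOf-maximum {J = J} {K = K} hJ iK K⊆X = isBasisOf-∪-maximum hJ∪K iK
      where
      hJ∪K : IsBasisOf J (J ∪ K)
      hJ∪K = record
        { subset      = p⊆p∪q K
        ; independent = independent hJ
        ; maximal     = λ y∈J∪K → maximal hJ (∪-⊆ (subset hJ) K⊆X y∈J∪K)
        }

    spanned-∈-isBasisOf : IsBasisOf J X → Spans X x → Independent M (J ∪ ⁅ x ⁆) → x ∈ J
    spanned-∈-isBasisOf {J = J} {X = X} {x = x} hJ (K , K⊆X , iK , dKx) iJx
      with extend-to-isBasisOf iK (⊆-trans K⊆X (p⊆p∪q ⁅ x ⁆))
    ... | K′ , K⊆K′ , hK′ = decidable-stable (x ∈? J) λ x∉J → <⇒≱ (∣J∣<∣Jx∣ x∉J) (begin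
      ∣ J ∪ ⁅ x ⁆ ∣ ≤⟨ isBasisOf-maximum hK′ iJx (∪-⊆ (⊆-trans (subset hJ) (p⊆p∪q ⁅ x ⁆)) (q⊆p∪q X ⁅ x ⁆)) ⟩
      ∣ K′ ∣        ≤⟨ isBasisOf-maximum hJ (independent hK′) K′⊆X ⟩
      ∣ J ∣         ∎)
      where
      open ≤-Reasoning
      x∉K′ : x ∉ K′
      x∉K′ x∈K′ = dKx (independent-⊆ (∪-⊆ K⊆K′ (x∈p⇒⁅x⁆⊆p x∈K′)) (independent hK′))
      K′⊆X : K′ ⊆ X
      K′⊆X = p⊆q∪⁅x⁆∧x∉p⇒p⊆q X (subset hK′) x∉K′
      ∣J∣<∣Jx∣ : x ∉ J → ∣ J ∣ < ∣ J ∪ ⁅ x ⁆ ∣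
      ∣J∣<∣Jx∣ x∉J = ≤-reflexive (sym (∣p∪⁅x⁆∣≡1+∣p∣ J x x∉J))

    isBasisOf-extend : IsBasisOf J X → X ⊆ Y → (∀ {y} → y ∈ Y → y ∉ X → Spans X y) → IsBasisOf J Y
    isBasisOf-extend {J = J} {X = X} {Y = Y} hJ X⊆Y spans = record
      { subset      = ⊆-trans (subset hJ) X⊆Y
      ; independent = independent hJ
      ; maximal     = maximal′
      }
      where
      maximal′ : ∀ {y} → y ∈ Y → Independent M (J ∪ ⁅ y ⁆) → y ∈ J
      maximal′ {y} y∈Y iJy with y ∈? X
      ... | yes y∈X = maximal hJ y∈X iJy
      ... | no y∉X = spanned-∈-isBasisOf hJ (spans y∈Y y∉X) iJy

    isBasisOf-insert : IsBasisOf J X → Spans X x → IsBasisOf J (X ∪ ⁅ x ⁆)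
    isBasisOf-insert {X = X} {x = x} hJ spans = isBasisOf-extend hJ (p⊆p∪q ⁅ x ⁆) λ y∈ y∉X →
      subst (Spans X) (sym (x∈⁅y⁆⇒x≡y x (x∈p∪q∧x∉p⇒x∈q X ⁅ x ⁆ y∈ y∉X))) spans

    basis⇒isBasisOf-⊤ : IsBasis M B → IsBasisOf B ⊤
    basis⇒isBasisOf-⊤ {B = B} b = record
      { subset      = ⊆⊤
      ; independent = basis⇒independent b
      ; maximal     = λ {y} _ iBy → decidable-stable (y ∈? B) λ y∉B → basis-insert-dependent b y∉B iBy
      }

    isBasisOf-⊤⇒basis : IsBasisOf J ⊤ → IsBasis M J
    isBasisOf-⊤⇒basis hJ with nonempty M
    ... | B , b = independent∧r≤∣∣⇒basis (independent hJ)
      (≤-trans (≤-reflexive (sym (rank B b))) (isBasisOf-maximum hJ (basis⇒independent b) ⊆⊤))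

    circuit-exchange : Independent M B → C ⊆ B ∪ ⁅ x ⁆ → IsCircuit M C → y ∈ C → y ≢ x →
                       Independent M ((B - y) ∪ ⁅ x ⁆)
    circuit-exchange {B = B} {C = C} {x = x} {y = y} iB C⊆Bx c y∈C y≢x
      with extend-to-isBasisOf (circuit-delete c y∈C) (⊆-trans (p─q⊆p C ⁅ y ⁆) C⊆Bx)
    ... | K , C-y⊆K , hK = independent-⊆ (p⊆q∧∣q∣≤∣p∣⇒q⊆p K⊆ ∣B-y∪x∣≤∣K∣) (independent hK)
      where
      y∉K : y ∉ K
      y∉K y∈K = proj₁ c (independent-⊆ (⊆-trans (p⊆p-x∪⁅x⁆ C y) (∪-⊆ C-y⊆K (x∈p⇒⁅x⁆⊆p y∈K))) (independent hK))
      K⊆ : K ⊆ (B - y) ∪ ⁅ x ⁆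
      K⊆ = p⊆q∪⁅x⁆∧y∉p⇒p⊆q-y∪⁅x⁆ B (subset hK) y∉K
      ∣B-y∪x∣≤∣K∣ : ∣ (B - y) ∪ ⁅ x ⁆ ∣ ≤ ∣ K ∣
      ∣B-y∪x∣≤∣K∣ = begin
        ∣ (B - y) ∪ ⁅ x ⁆ ∣ ≤⟨ ∣p∪⁅x⁆∣≤1+∣p∣ (B - y) x ⟩
        suc ∣ B - y ∣       ≡⟨ 1+∣p-x∣≡∣p∣ B y (x∈p∪⁅y⁆∧x≢y⇒x∈p B (C⊆Bx y∈C) y≢x) ⟩
        ∣ B ∣               ≤⟨ isBasisOf-maximum hK iB (p⊆p∪q ⁅ x ⁆) ⟩
        ∣ K ∣               ∎
        where open ≤-Reasoning

    insert-delete-independent : Independent M B → C ⊆ B ∪ ⁅ x ⁆ → IsCircuit M C → y ∈ C →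
                                Independent M ((B ∪ ⁅ x ⁆) - y)
    insert-delete-independent {B = B} {x = x} {y = y} iB C⊆Bx c y∈C with y ≟ x
    ... | yes refl = independent-⊆ (p⊆q∪⁅x⁆⇒p-x⊆q (B ∪ ⁅ x ⁆) B x ⊆-refl) iB
    ... | no y≢x = independent-⊆
      (p⊆q∪⁅x⁆∧y∉p⇒p⊆q-y∪⁅x⁆ B (p─q⊆p (B ∪ ⁅ x ⁆) ⁅ y ⁆) λ y∈ → x∈p-y⇒x≢y (B ∪ ⁅ x ⁆) y∈ refl)
      (circuit-exchange iB C⊆Bx c y∈C y≢x)

    circuit-augments-deletion : Independent M B → x ∈ B → IsCircuit M C → x ∈ C →
                                ∃ λ y → y ∈ C × y ∉ B × Independent M ((B - x) ∪ ⁅ y ⁆)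
    circuit-augments-deletion {B = B} {x = x} {C = C} iB x∈B c x∈C
      with augment⊎isBasisOf (independent-⊆ (p─q⊆p B ⁅ x ⁆) iB) (p⊆p∪q (C - x))
    ... | inj₁ (y , y∈ , y∉B-x , iB-x∪y) = y , p─q⊆p C ⁅ x ⁆ y∈C-x , y∉B , iB-x∪y
      where
      y∈C-x : y ∈ C - x
      y∈C-x = x∈p∪q∧x∉p⇒x∈q (B - x) (C - x) y∈ y∉B-x
      y∉B : y ∉ B
      y∉B y∈B = y∉B-x (x∈p∧x≢y⇒x∈p-y y∈B (x∈p-y⇒x≢y C y∈C-x))
    ... | inj₂ hB-x = contradiction refl (x∈p-y⇒x≢y B x∈B-x)
      where
      x∈B-x : x ∈ B - x
      x∈B-x = spanned-∈-isBasisOf hB-x (spans-⊆ (q⊆p∪q (B - x) (C - x)) (circuit⇒spans c x∈C))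
        (independent-⊆ (∪-⊆ (p─q⊆p B ⁅ x ⁆) (x∈p⇒⁅x⁆⊆p x∈B)) iB)

    △-pair-basisˡ : IsBasis M B → x ∈ B → y ∉ B → Independent M ((B - x) ∪ ⁅ y ⁆) →
                    IsBasis M (B △ (⁅ x ⁆ ∪ ⁅ y ⁆))
    △-pair-basisˡ {B = B} b x∈B y∉B iS rewrite p△⁅x⁆∪⁅y⁆≡p-x∪⁅y⁆ B x∈B y∉B =
      independent∧∣∣≡r⇒basis iS (trans (∣p-x∪⁅y⁆∣≡∣p∣ B x∈B y∉B) (rank B b))

    △-pair-basisʳ : IsBasis M B → y ∈ B → x ∉ B → Independent M ((B - y) ∪ ⁅ x ⁆) →
                    IsBasis M (B △ (⁅ x ⁆ ∪ ⁅ y ⁆))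
    △-pair-basisʳ {B = B} b y∈B x∉B iS rewrite p△⁅x⁆∪⁅y⁆≡p-y∪⁅x⁆ B y∈B x∉B =
      independent∧∣∣≡r⇒basis iS (trans (∣p-x∪⁅y⁆∣≡∣p∣ B y∈B x∉B) (rank B b))

module Quotient {n : ℕ} {M₁ M₂ : Matroid n} (quotient : IsQuotient M₁ M₂) where

  private
    module M₁ = MatroidProperties M₁
    module M₂ = MatroidProperties M₂
    variable
      I J₁ J₂ X : Subset n

  independent₂⇒independent₁ : Independent M₂ I → Independent M₁ I
  independent₂⇒independent₁ {I = I} iI = decidable-stable (M₁.independent? I) ¬dependent₁
    where
    ¬dependent₁ : ¬ Dependent M₁ I
    ¬dependent₁ dI with M₁.dependent⇒⊇circuit dI
    ... | C , C⊆I , c with M₁.circuit-nonempty c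
    ...   | x , x∈C with quotient C c x x∈C
    ...     | D , d , D⊆C , _ = proj₁ d (M₂.independent-⊆ (⊆-trans D⊆C C⊆I) iI)

  spans₁⇒spans₂ : M₁.Spans X x → M₂.Spans X x
  spans₁⇒spans₂ {X = X} {x = x} spans with M₁.spans⇒circuit spans
  ... | C , c , C⊆Xx , x∈C with quotient C c x x∈C
  ...   | D , d , D⊆C , x∈D =
    M₂.spans-⊆ (p⊆q∪⁅x⁆⇒p-x⊆q D X x (⊆-trans D⊆C C⊆Xx)) (M₂.circuit⇒spans d x∈D)

  isBasisOf-quotient : ∀ {r} → HasRank M₂ r → M₁.IsBasisOf J₁ X → M₂.IsBasisOf J₂ J₁ → M₂.IsBasisOf J₂ X
  isBasisOf-quotient rank₂ hJ₁ hJ₂ = RankedMatroid.isBasisOf-extend M₂ rank₂ hJ₂ (M₁.subset hJ₁)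
    λ y∈X y∉J₁ → spans₁⇒spans₂ (M₁.isBasisOf⇒spans hJ₁ y∈X y∉J₁)

module RankedQuotient {n : ℕ} {M₁ M₂ : Matroid n} (quotient : IsQuotient M₁ M₂)
                      {r₁ r₂ : ℕ} (rank₁ : HasRank M₁ r₁) (rank₂ : HasRank M₂ r₂) where

  open Quotient {M₁ = M₁} {M₂ = M₂} quotient public

  private
    module M₁ = RankedMatroid M₁ rank₁
    module M₂ = RankedMatroid M₂ rank₂
    variable
      B C : Subset n

  basis₁⊇basis₂ : IsBasis M₁ B → ∃ λ B′ → B′ ⊆ B × IsBasis M₂ B′
  basis₁⊇basis₂ {B = B} b with M₂.isBasisOf-exists B
  ... | B′ , hB′ = B′ , M₂.subset hB′ ,
    M₂.isBasisOf-⊤⇒basis (isBasisOf-quotient rank₂ (M₁.basis⇒isBasisOf-⊤ b) hB′)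

  dependent₂-augments₁ : Independent M₂ B → Independent M₁ C → Dependent M₂ C →
                         ∃ λ x → x ∈ C × x ∉ B × Independent M₁ (B ∪ ⁅ x ⁆)
  dependent₂-augments₁ {B = B} {C = C} iB₂ iC₁ dC₂
    with M₁.augment⊎isBasisOf (independent₂⇒independent₁ iB₂) (p⊆p∪q C)
  ... | inj₁ (x , x∈B∪C , x∉B , iBx₁) = x , x∈p∪q∧x∉p⇒x∈q B C x∈B∪C x∉B , x∉B , iBx₁
  ... | inj₂ hB with M₁.extend-to-isBasisOf iC₁ (q⊆p∪q B C)
  ...   | K , C⊆K , hK with M₂.isBasisOf-exists K
  ...     | J , hJ = contradiction (M₂.independent-⊆ (⊆-trans C⊆K K⊆J) (M₂.independent hJ)) dC₂
    where
    K⊆J : K ⊆ J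
    K⊆J = p⊆q∧∣q∣≤∣p∣⇒q⊆p (M₂.subset hJ) (begin
      ∣ K ∣ ≤⟨ M₁.isBasisOf-maximum hB (M₁.independent hK) (M₁.subset hK) ⟩
      ∣ B ∣ ≤⟨ M₂.isBasisOf-maximum (isBasisOf-quotient rank₂ hK hJ) iB₂ (p⊆p∪q C) ⟩
      ∣ J ∣ ∎)
      where open ≤-Reasoning

module ElementaryQuotient {n : ℕ} (k : ℕ) (M₁ M₂ : Matroid n)
                          (rank₁ : HasRank M₁ (suc k)) (rank₂ : HasRank M₂ k) where

  private
    module M₁ = RankedMatroid M₁ rank₁
    module M₂ = RankedMatroid M₂ rank₂
    variable
      B₁ B₂ C X : Subset n
      i : Fin n

  SwapOne : Subset n → Subset n → Fin n → Set
  SwapOne B₁ B₂ i = IsBasis M₂ (B₁ △ ⁅ i ⁆) × IsBasis M₁ (B₂ △ ⁅ i ⁆)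

  SwapTwo : Subset n → Subset n → Fin n → Set
  SwapTwo B₁ B₂ i = ∃ λ j → j ∈ B₁ △ B₂ ×
    IsBasis M₁ (B₁ △ (⁅ i ⁆ ∪ ⁅ j ⁆)) × IsBasis M₂ (B₂ △ (⁅ i ⁆ ∪ ⁅ j ⁆))

  PropertyA : Set
  PropertyA = ∀ B₁ B₂ → IsBasis M₁ B₁ → IsBasis M₂ B₂ → ∀ i → i ∈ B₁ △ B₂ →
              SwapOne B₁ B₂ i ⊎ SwapTwo B₁ B₂ i

  PropertyB : Set
  PropertyB = ∀ B₁ B₂ → IsBasis M₁ B₁ → IsBasis M₂ B₂ → ∃ λ i → i ∈ B₁ △ B₂ × SwapOne B₁ B₂ i

  ∣basis₁-i∣≡k : IsBasis M₁ B₁ → i ∈ B₁ → ∣ B₁ - i ∣ ≡ k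
  ∣basis₁-i∣≡k {B₁ = B₁} {i = i} b₁ i∈B₁ = suc-injective (trans (1+∣p-x∣≡∣p∣ B₁ i i∈B₁) (rank₁ B₁ b₁))

  swapOne-intro : IsBasis M₁ B₁ → IsBasis M₂ B₂ → i ∈ B₁ → i ∉ B₂ →
                  Independent M₂ (B₁ - i) → Independent M₁ (B₂ ∪ ⁅ i ⁆) → SwapOne B₁ B₂ i
  swapOne-intro {B₁ = B₁} {B₂ = B₂} {i = i} b₁ b₂ i∈B₁ i∉B₂ iB₁-i iB₂∪i
    rewrite p△⁅x⁆≡p-x B₁ i∈B₁ | p△⁅x⁆≡p∪⁅x⁆ B₂ i∉B₂ =
      M₂.independent∧∣∣≡r⇒basis iB₁-i (∣basis₁-i∣≡k b₁ i∈B₁) ,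
      M₁.independent∧∣∣≡r⇒basis iB₂∪i (trans (∣p∪⁅x⁆∣≡1+∣p∣ B₂ i i∉B₂) (cong suc (rank₂ B₂ b₂)))

  module Forward (quotient : IsQuotient M₁ M₂) where

    open RankedQuotient {M₁ = M₁} {M₂ = M₂} quotient rank₁ rank₂

    basis₁-delete-circuit₂ : IsBasis M₁ B₁ → C ⊆ B₁ → IsCircuit M₂ C → i ∈ C → Independent M₂ (B₁ - i)
    basis₁-delete-circuit₂ {B₁ = B₁} {C = C} {i = i} b₁ C⊆B₁ c i∈C with basis₁⊇basis₂ b₁
    ... | B , B⊆B₁ , b with p⊈q⇒∃x∈p∧x∉q (λ C⊆B → proj₁ c (M₂.independent-⊆ C⊆B (M₂.basis⇒independent b)))
    ...   | y , y∈C , y∉B = M₂.independent-⊆ (p⊆q⇒p-x⊆q-x B₁ i B₁⊆By)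
      (M₂.insert-delete-independent (M₂.basis⇒independent b) (⊆-trans C⊆B₁ B₁⊆By) c i∈C)
      where
      B₁⊆By : B₁ ⊆ B ∪ ⁅ y ⁆
      B₁⊆By = p⊆q∧∣q∣≤∣p∣⇒q⊆p (∪-⊆ B⊆B₁ (x∈p⇒⁅x⁆⊆p (C⊆B₁ y∈C)))
        (≤-reflexive (trans (rank₁ B₁ b₁) (sym (trans (∣p∪⁅x⁆∣≡1+∣p∣ B y y∉B) (cong suc (rank₂ B b))))))

    quotient⇒propertyB : PropertyB
    quotient⇒propertyB B₁ B₂ b₁ b₂
      with M₂.dependent⇒⊇circuit (M₂.r<∣∣⇒dependent (≤-reflexive (sym (rank₁ B₁ b₁))))
    ... | C , C⊆B₁ , c
      with dependent₂-augments₁ (M₂.basis⇒independent b₂)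
             (M₁.independent-⊆ C⊆B₁ (M₁.basis⇒independent b₁)) (proj₁ c)
    ...   | i , i∈C , i∉B₂ , iB₂∪i = i , x∈p△q⁺ˡ (C⊆B₁ i∈C) i∉B₂ ,
      swapOne-intro b₁ b₂ (C⊆B₁ i∈C) i∉B₂ (basis₁-delete-circuit₂ b₁ C⊆B₁ c i∈C) iB₂∪i

    swapTwo-of-∈₂ : IsBasis M₁ B₁ → IsBasis M₂ B₂ → i ∈ B₂ → i ∉ B₁ → SwapTwo B₁ B₂ i
    swapTwo-of-∈₂ {B₁ = B₁} {B₂ = B₂} {i = i} b₁ b₂ i∈B₂ i∉B₁ with M₁.fundamental-circuit b₁ i∉B₁
    ... | C , C⊆B₁i , c , i∈C with quotient C c i i∈C
    ...   | D , d , D⊆C , i∈D with M₂.circuit-augments-deletion (M₂.basis⇒independent b₂) i∈B₂ d i∈D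
    ...     | j , j∈D , j∉B₂ , iB₂-i∪j = j , x∈p△q⁺ˡ j∈B₁ j∉B₂ ,
      M₁.△-pair-basisʳ b₁ j∈B₁ i∉B₁ (M₁.circuit-exchange (M₁.basis⇒independent b₁) C⊆B₁i c (D⊆C j∈D) j≢i) ,
      M₂.△-pair-basisˡ b₂ i∈B₂ j∉B₂ iB₂-i∪j
      where
      j≢i : j ≢ i
      j≢i refl = j∉B₂ i∈B₂
      j∈B₁ : j ∈ B₁
      j∈B₁ = x∈p∪⁅y⁆∧x≢y⇒x∈p B₁ (C⊆B₁i (D⊆C j∈D)) j≢i

    basis₁-delete-independent₂ : IsBasis M₁ B₁ → i ∈ B₁ → M₁.IsBasisOf (B₁ - i) X → M₂.Spans X i →
                                 Independent M₂ (B₁ - i)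
    basis₁-delete-independent₂ {B₁ = B₁} {i = i} {X = X} b₁ i∈B₁ hA spans
      with M₂.isBasisOf-exists (B₁ - i) | basis₁⊇basis₂ b₁
    ... | J , hJ | B , B⊆B₁ , b = M₂.independent-⊆ A⊆J (M₂.independent hJ)
      where
      hJ′ : M₂.IsBasisOf J (X ∪ ⁅ i ⁆)
      hJ′ = M₂.isBasisOf-insert (isBasisOf-quotient rank₂ hA hJ) spans
      B₁⊆X∪i : B₁ ⊆ X ∪ ⁅ i ⁆
      B₁⊆X∪i = ⊆-trans (p⊆p-x∪⁅x⁆ B₁ i) (∪-monoˡ-⊆ ⁅ i ⁆ (M₁.subset hA))
      A⊆J : B₁ - i ⊆ J
      A⊆J = p⊆q∧∣q∣≤∣p∣⇒q⊆p (M₂.subset hJ) (begin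
        ∣ B₁ - i ∣ ≡⟨ trans (∣basis₁-i∣≡k b₁ i∈B₁) (sym (rank₂ B b)) ⟩
        ∣ B ∣      ≤⟨ M₂.isBasisOf-maximum hJ′ (M₂.basis⇒independent b) (⊆-trans B⊆B₁ B₁⊆X∪i) ⟩
        ∣ J ∣      ∎)
        where open ≤-Reasoning

    swapOne-of-isBasisOf : IsBasis M₁ B₁ → IsBasis M₂ B₂ → i ∈ B₁ → i ∉ B₂ →
                           C ⊆ B₂ ∪ ⁅ i ⁆ → IsCircuit M₂ C → i ∈ C →
                           M₁.IsBasisOf (B₁ - i) ((B₁ - i) ∪ (C - i)) → SwapOne B₁ B₂ i
    swapOne-of-isBasisOf {B₁ = B₁} {B₂ = B₂} {i = i} {C = C} b₁ b₂ i∈B₁ i∉B₂ C⊆B₂i c i∈C hA =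
      swapOne-intro b₁ b₂ i∈B₁ i∉B₂
        (basis₁-delete-independent₂ b₁ i∈B₁ hA (M₂.spans-⊆ (q⊆p∪q (B₁ - i) (C - i)) (M₂.circuit⇒spans c i∈C)))
        iB₂∪i₁
      where
      ¬spans₁ : ¬ M₁.Spans (C - i) i
      ¬spans₁ spans = x∈p-y⇒x≢y B₁ i∈B₁-i refl
        where
        i∈B₁-i : i ∈ B₁ - i
        i∈B₁-i = M₁.spanned-∈-isBasisOf hA (M₁.spans-⊆ (q⊆p∪q (B₁ - i) (C - i)) spans)
          (M₁.independent-⊆ (∪-⊆ (p─q⊆p B₁ ⁅ i ⁆) (x∈p⇒⁅x⁆⊆p i∈B₁)) (M₁.basis⇒independent b₁))
      iC₁ : Independent M₁ C
      iC₁ = M₁.independent-⊆ (p⊆p-x∪⁅x⁆ C i) (M₁.¬spans⇒insert-independent iC-i₁ ¬spans₁)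
        where
        iC-i₁ : Independent M₁ (C - i)
        iC-i₁ = independent₂⇒independent₁
          (M₂.independent-⊆ (p⊆q∪⁅x⁆⇒p-x⊆q C B₂ i C⊆B₂i) (M₂.basis⇒independent b₂))
      iB₂∪i₁ : Independent M₁ (B₂ ∪ ⁅ i ⁆)
      iB₂∪i₁ with dependent₂-augments₁ (M₂.basis⇒independent b₂) iC₁ (proj₁ c)
      ... | x , x∈C , x∉B₂ , iB₂x rewrite x∈⁅y⁆⇒x≡y i (x∈p∪q∧x∉p⇒x∈q B₂ ⁅ i ⁆ (C⊆B₂i x∈C) x∉B₂) = iB₂x

    swapOne⊎swapTwo-of-∈₁ : IsBasis M₁ B₁ → IsBasis M₂ B₂ → i ∈ B₁ → i ∉ B₂ →
                            SwapOne B₁ B₂ i ⊎ SwapTwo B₁ B₂ i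
    swapOne⊎swapTwo-of-∈₁ {B₁ = B₁} {B₂ = B₂} {i = i} b₁ b₂ i∈B₁ i∉B₂ with M₂.fundamental-circuit b₂ i∉B₂
    ... | C , C⊆B₂i , c , i∈C
      with M₁.augment⊎isBasisOf (M₁.independent-⊆ (p─q⊆p B₁ ⁅ i ⁆) (M₁.basis⇒independent b₁)) (p⊆p∪q (C - i))
    ...   | inj₂ hA = inj₁ (swapOne-of-isBasisOf b₁ b₂ i∈B₁ i∉B₂ C⊆B₂i c i∈C hA)
    ...   | inj₁ (j , j∈ , j∉B₁-i , iB₁-i∪j) = inj₂ (j , x∈p△q⁺ʳ j∈B₂ j∉B₁ ,
      M₁.△-pair-basisˡ b₁ i∈B₁ j∉B₁ iB₁-i∪j ,
      M₂.△-pair-basisʳ b₂ j∈B₂ i∉B₂ (M₂.circuit-exchange (M₂.basis⇒independent b₂) C⊆B₂i c j∈C j≢i))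
      where
      j∈C-i : j ∈ C - i
      j∈C-i = x∈p∪q∧x∉p⇒x∈q (B₁ - i) (C - i) j∈ j∉B₁-i
      j∈C : j ∈ C
      j∈C = p─q⊆p C ⁅ i ⁆ j∈C-i
      j≢i : j ≢ i
      j≢i = x∈p-y⇒x≢y C j∈C-i
      j∈B₂ : j ∈ B₂
      j∈B₂ = x∈p∪⁅y⁆∧x≢y⇒x∈p B₂ (C⊆B₂i j∈C) j≢i
      j∉B₁ : j ∉ B₁
      j∉B₁ j∈B₁ = j∉B₁-i (x∈p∧x≢y⇒x∈p-y j∈B₁ j≢i)

    quotient⇒propertyA : PropertyA
    quotient⇒propertyA B₁ B₂ b₁ b₂ i i∈B₁△B₂ with x∈p△q⁻ B₁ B₂ i∈B₁△B₂
    ... | inj₁ (i∈B₁ , i∉B₂) = swapOne⊎swapTwo-of-∈₁ b₁ b₂ i∈B₁ i∉B₂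
    ... | inj₂ (i∈B₂ , i∉B₁) = inj₂ (swapTwo-of-∈₂ b₁ b₂ i∈B₂ i∉B₁)

  module Backward (propertyA : PropertyA) where

    exchange₁₂ : IsBasis M₁ B₁ → IsBasis M₂ B₂ → i ∈ B₂ → i ∉ B₁ →
      ∃ λ j → j ∈ B₁ × j ∉ B₂ × IsBasis M₁ ((B₁ - j) ∪ ⁅ i ⁆) × IsBasis M₂ ((B₂ - i) ∪ ⁅ j ⁆)
    exchange₁₂ {B₁ = B₁} {B₂ = B₂} {i = i} b₁ b₂ i∈B₂ i∉B₁ with propertyA B₁ B₂ b₁ b₂ i (x∈p△q⁺ʳ i∈B₂ i∉B₁)
    ... | inj₁ (b₂′ , _) = contradiction
      (M₂.independent-⊆ (p⊆p∪q ⁅ i ⁆) (M₂.basis⇒independent (subst (IsBasis M₂) (p△⁅x⁆≡p∪⁅x⁆ B₁ i∉B₁) b₂′)))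
      (M₂.r<∣∣⇒dependent (≤-reflexive (sym (rank₁ B₁ b₁))))
    ... | inj₂ (j , j∈B₁△B₂ , b₁′ , b₂′) with x∈p△q⁻ B₁ B₂ j∈B₁△B₂
    ...   | inj₂ (_ , j∉B₁) = contradiction
      (M₁.independent-⊆ (p∪⁅x⁆⊆p△⁅x⁆∪⁅y⁆ B₁ i∉B₁ j∉B₁) (M₁.basis⇒independent b₁′))
      (M₁.basis-insert-dependent b₁ i∉B₁)
    ...   | inj₁ (j∈B₁ , j∉B₂) = j , j∈B₁ , j∉B₂ ,
      subst (IsBasis M₁) (p△⁅x⁆∪⁅y⁆≡p-y∪⁅x⁆ B₁ j∈B₁ i∉B₁) b₁′ ,
      subst (IsBasis M₂) (p△⁅x⁆∪⁅y⁆≡p-x∪⁅y⁆ B₂ i∈B₂ j∉B₂) b₂′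

    circuit₁⇒spans₂ : IsCircuit M₁ C → x ∈ C → M₂.Spans (C - x) x
    circuit₁⇒spans₂ {C = C} {x = x} c x∈C with M₂.isBasisOf-exists (C - x)
    ... | J , hJ = J , M₂.subset hJ , M₂.independent hJ , ¬independent
      where
      ¬independent : ¬ Independent M₂ (J ∪ ⁅ x ⁆)
      ¬independent (B₂ , b₂ , Jx⊆B₂) with M₁.circuit-delete c x∈C
      ... | B₁ , b₁ , C-x⊆B₁ with exchange₁₂ b₁ b₂ (Jx⊆B₂ (q⊆p∪q J ⁅ x ⁆ (x∈⁅x⁆ x)))
                                    (M₁.circuit-delete-⊆⇒∉ c (M₁.basis⇒independent b₁) C-x⊆B₁)
      ...   | j , j∈B₁ , j∉B₂ , b₁′ , b₂′ = j∉B₂ (Jx⊆B₂ (p⊆p∪q ⁅ x ⁆ j∈J))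
        where
        j∈C-x : j ∈ C - x
        j∈C-x = decidable-stable (j ∈? (C - x)) λ j∉C-x →
          M₁.circuit-delete-⊆⇒∉ c (M₁.basis⇒independent b₁′)
            (λ y∈ → p⊆p∪q ⁅ x ⁆ (x∈p∧x≢y⇒x∈p-y (C-x⊆B₁ y∈) λ { refl → j∉C-x y∈ }))
            (q⊆p∪q (B₁ - j) ⁅ x ⁆ (x∈⁅x⁆ x))
        j∈J : j ∈ J
        j∈J = M₂.maximal hJ j∈C-x (M₂.independent-⊆ (∪-monoˡ-⊆ ⁅ j ⁆ J⊆B₂-x) (M₂.basis⇒independent b₂′))
          where
          J⊆B₂-x : J ⊆ B₂ - x
          J⊆B₂-x y∈J = x∈p∧x≢y⇒x∈p-y (Jx⊆B₂ (p⊆p∪q ⁅ x ⁆ y∈J)) (x∈p-y⇒x≢y C (M₂.subset hJ y∈J))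

    propertyA⇒quotient : IsQuotient M₁ M₂
    propertyA⇒quotient C c x x∈C with M₂.spans⇒circuit (circuit₁⇒spans₂ c x∈C)
    ... | D , d , D⊆ , x∈D = D , d , ⊆-trans D⊆ (∪-⊆ (p─q⊆p C ⁅ x ⁆) (x∈p⇒⁅x⁆⊆p x∈C)) , x∈D

  elementaryQuotient⇒properties : IsElementaryQuotient M₁ M₂ → PropertyA × PropertyB
  elementaryQuotient⇒properties (quotient , _) = quotient⇒propertyA , quotient⇒propertyB
    where open Forward quotient

  properties⇒elementaryQuotient : PropertyA × PropertyB → IsElementaryQuotient M₁ M₂
  properties⇒elementaryQuotient (propertyA , _) = propertyA⇒quotient , k , rank₁ , rank₂
    where open Backward propertyA

mainTheorem4 : ∀ {n} (k : ℕ) (M₁ M₂ : Matroid n) →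
    HasRank M₁ (suc k) → HasRank M₂ k →
    IsElementaryQuotient M₁ M₂ ⇔
      ((∀ B₁ B₂ → IsBasis M₁ B₁ → IsBasis M₂ B₂ → ∀ i → i ∈ B₁ △ B₂ →
          (IsBasis M₂ (B₁ △ ⁅ i ⁆) × IsBasis M₁ (B₂ △ ⁅ i ⁆))
          ⊎ (∃ λ j → j ∈ B₁ △ B₂ ×
               IsBasis M₁ (B₁ △ (⁅ i ⁆ ∪ ⁅ j ⁆)) × IsBasis M₂ (B₂ △ (⁅ i ⁆ ∪ ⁅ j ⁆))))
       × (∀ B₁ B₂ → IsBasis M₁ B₁ → IsBasis M₂ B₂ →
          ∃ λ i → i ∈ B₁ △ B₂ ×
            IsBasis M₂ (B₁ △ ⁅ i ⁆) × IsBasis M₁ (B₂ △ ⁅ i ⁆)))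
mainTheorem4 k M₁ M₂ rank₁ rank₂ = mk⇔ elementaryQuotient⇒properties properties⇒elementaryQuotient
  where open ElementaryQuotient k M₁ M₂ rank₁ rank₂
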